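{- For any graph $G$ and any $t\geq 2$, the complement of $M^t(G)$ is a Hamiltonian graph.
   Context: Graphs are finite, simple, undirected. For $V=\{v_1,\dots,v_n\}$, the Mycielski graph $M(G)$ has vertex set $V\cup\{v_1',\dots,v_n'\}\cup\{u\}$ and edge set $E\cup\{v_iv_j' : v_iv_j\in E\}\cup\{v_i'u: 1\le i\le n\}$; $M^0(G)=G$ and $M^t(G)=M(M^{t-1}(G))$ for $t\ge1$. -}

module Defs where

open import Data.Nat using (ℕ; zero; suc; _+_; _≥_)
open import Data.Fin using (Fin; zero; suc; splitAt; inject₁; fromℕ)
open import Data.Sum using (_⊎_; inj₁; inj₂)
open import Data.Product using (Σ; _×_; _,_)
open import Data.Unit using (⊤)
open import Data.Empty using (⊥)
open import Relation.Nullary using (¬_)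
open import Relation.Binary.PropositionalEquality using (_≡_; _≢_)
open import Function.Definitions using (Bijective)

record Graph : Set₁ where
  constructor mkGraph
  field
    n   : ℕ
    Adj : Fin n → Fin n → Set
open Graph public

IsSimple : Graph → Set
IsSimple G = (∀ i j → Adj G i j → Adj G j i) × (∀ i → ¬ Adj G i i)

-- Vertices of M(G): originals v_i, copies v_i', and the apex u.
data Kind (n : ℕ) : Set where
  orig  : Fin n → Kind n
  prime : Fin n → Kind n
  apex  : Kind n

-- Layout of Fin (n + (n + 1)): first n = v_i, next n = v_i', last = u.
kind : ∀ {n} → Fin (n + (n + 1)) → Kind n
kind {n} x with splitAt n x
... | inj₁ i = orig i
... | inj₂ y with splitAt n {1} y
...   | inj₁ j = prime j
...   | inj₂ _ = apex

MAdjK : ∀ {n} → (Fin n → Fin n → Set) → Kind n → Kind n → Set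
MAdjK A (orig i)  (orig j)  = A i j
MAdjK A (orig i)  (prime j) = A i j
MAdjK A (prime i) (orig j)  = A j i
MAdjK A (prime _) apex      = ⊤
MAdjK A apex      (prime _) = ⊤
MAdjK A _         _         = ⊥

M : Graph → Graph
M (mkGraph n A) = mkGraph (n + (n + 1)) (λ x y → MAdjK A (kind x) (kind y))

M^ : ℕ → Graph → Graph
M^ zero    G = G
M^ (suc t) G = M (M^ t G)

complement : Graph → Graph
complement (mkGraph n A) = mkGraph n (λ i j → (i ≢ j) × ¬ A i j)

HasHamCycle : (m : ℕ) → (Fin (suc m) → Fin (suc m) → Set) → Set
HasHamCycle m A =
  (m ≥ 2) ×
  Σ (Fin (suc m) → Fin (suc m)) λ f →
    Bijective _≡_ _≡_ f ×
    (∀ (i : Fin m) → A (f (inject₁ i)) (f (suc i))) ×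
    A (f (fromℕ m)) (f zero)

IsHamiltonian : Graph → Set
IsHamiltonian (mkGraph zero    A) = ⊥
IsHamiltonian (mkGraph (suc m) A) = HasHamCycle m A

-- Let H' = M(H) have vertices a_i, b_i = a_i', c (the apex), and write v_x, v_x', u for the
-- vertices of M(H'). In the complement of M(H'), u is adjacent to every v_x, any two v_x' are
-- adjacent, and v_x v_y, v_x v_y' are edges as soon as x ≁ y in H'. Since a_i ≁ a_i, b_i ≁ b_i,
-- c ≁ c and b_i ≁ a_i in H', the sequence
--   u, v_{a₀}, v'_{a₀}, v_{b₀}, v'_{b₀},
--   v'_{bⱼ}, v_{bⱼ}, v_{aⱼ}, v'_{aⱼ}   (j = 1, …, n-1),
--   v'_c, v_c
-- is a Hamiltonian cycle of the complement, for every loopless H with n ≥ 1 vertices.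
-- The theorem is the case H = M^{t-2}(G).
module Submission where

open import Data.Empty using (⊥-elim)
open import Data.Fin using (Fin; zero; suc; toℕ; cast; inject₁; fromℕ; punchOut; _↑ˡ_; _↑ʳ_)
open import Data.Fin.Properties
  using (toℕ-injective; toℕ-cast; toℕ-inject₁; toℕ-fromℕ; punchOut-injective; injective⇒≤; any?; _≟_; splitAt-↑ˡ; splitAt-↑ʳ)
  renaming (suc-injective to Fin-suc-injective)
open import Data.List using (List; []; _∷_; length; lookup; tabulate; allFin)
open import Data.List.Properties using (length-tabulate)
open import Data.List.Relation.Unary.Linked using (Linked; [-]; _∷_)
open import Data.Nat using (ℕ; zero; suc; _+_; _*_; _≥_; s≤s; z≤n)
open import Data.Nat.Properties using (+-identityʳ; +-suc; 1+n≰n; m≤n+m; ≤-trans; suc-injective)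
open import Data.Nat.Tactic.RingSolver using (solve-∀)
open import Data.Product using (_×_; _,_)
open import Data.Unit using (⊤; tt)
open import Function using (_∘_; id)
open import Function.Definitions using (Injective; Surjective)
open import Relation.Binary.PropositionalEquality using (_≡_; _≢_; refl; sym; trans; cong; subst; module ≡-Reasoning)
open import Relation.Nullary using (¬_; yes; no)
open import Defs

injective⇒surjective : ∀ {n} {f : Fin n → Fin n} → Injective _≡_ _≡_ f → Surjective _≡_ _≡_ f
injective⇒surjective {suc n} {f} f-inj y with any? (λ x → f x ≟ y)
... | yes (x , fx≡y) = x , λ { refl → fx≡y }
... | no ∄x = ⊥-elim (1+n≰n (injective⇒≤ g-inj))
  where
  y≢f : ∀ x → y ≢ f x
  y≢f x y≡fx = ∄x (x , sym y≡fx)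

  -- Missing y, f would inject Fin (suc n) into Fin n.
  g : Fin (suc n) → Fin n
  g x = punchOut (y≢f x)

  g-inj : Injective _≡_ _≡_ g
  g-inj gx≡gx′ = f-inj (punchOut-injective (y≢f _) (y≢f _) gx≡gx′)

inject₁≢suc : ∀ {n} (i : Fin n) → inject₁ i ≢ suc i
inject₁≢suc zero    ()
inject₁≢suc (suc i) = inject₁≢suc i ∘ Fin-suc-injective

Numbered : ∀ {A : Set} → (A → ℕ) → ℕ → List A → Set
Numbered pos k []       = ⊤
Numbered pos k (x ∷ xs) = pos x ≡ k × Numbered pos (suc k) xs

numbered-lookup : ∀ {A : Set} {pos : A → ℕ} {k} (xs : List A) → Numbered pos k xs →
                  ∀ i → pos (lookup xs i) ≡ k + toℕ i
numbered-lookup {k = k} (x ∷ xs) (px≡k , _)  zero    = trans px≡k (sym (+-identityʳ k))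
numbered-lookup {k = k} (x ∷ xs) (_ , num-xs) (suc i) =
  trans (numbered-lookup xs num-xs i) (sym (+-suc k (toℕ i)))

numbered-tabulate : ∀ {A : Set} {pos : A → ℕ} {k n} (f : Fin n → A) →
                    (∀ i → pos (f i) ≡ k + toℕ i) → Numbered pos k (tabulate f)
numbered-tabulate {n = zero}          f pos-f = tt
numbered-tabulate {k = k} {n = suc n} f pos-f =
  trans (pos-f zero) (+-identityʳ k) ,
  numbered-tabulate (f ∘ suc) (λ i → trans (pos-f (suc i)) (+-suc k (toℕ i)))

last⁺ : ∀ {A : Set} → A → List A → A
last⁺ x []       = x
last⁺ _ (y ∷ ys) = last⁺ y ys

lookup-last⁺ : ∀ {A : Set} (x : A) (xs : List A) (i : Fin (suc (length xs))) →
               toℕ i ≡ length xs → lookup (x ∷ xs) i ≡ last⁺ x xs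
lookup-last⁺ x []       zero    _ = refl
lookup-last⁺ x (y ∷ ys) (suc i) i≡len = lookup-last⁺ y ys i (suc-injective i≡len)

linked-lookup : ∀ {A : Set} {R : A → A → Set} {xs : List A} → Linked R xs →
                ∀ i j → toℕ j ≡ suc (toℕ i) → R (lookup xs i) (lookup xs j)
linked-lookup (Rxy ∷ _)  zero    (suc zero) _    = Rxy
linked-lookup (_ ∷ Rxs)  (suc i) (suc j)    j≡1+i = linked-lookup Rxs i j (suc-injective j≡1+i)

-- The numbering makes the entries of x ∷ xs distinct, and there are as many as vertices.
linked⇒hamCycle : ∀ {m} {R : Fin (suc m) → Fin (suc m) → Set} {pos : Fin (suc m) → ℕ}
                  {x : Fin (suc m)} {xs : List (Fin (suc m))} →
                  m ≥ 2 → length xs ≡ m → Numbered pos 0 (x ∷ xs) →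
                  Linked R (x ∷ xs) → R (last⁺ x xs) x →
                  HasHamCycle m (λ i j → i ≢ j × R i j)
linked⇒hamCycle {m} {R} {pos} {x} {xs} m≥2@(s≤s (s≤s _)) len num linked closing =
  m≥2 , f , (f-inj , injective⇒surjective f-inj) ,
  (λ i → f-separates (inject₁≢suc i) , step i) ,
  f-separates {fromℕ m} {zero} (λ ()) , closes
  where
  open ≡-Reasoning

  len′ : suc m ≡ length (x ∷ xs)
  len′ = cong suc (sym len)

  f : Fin (suc m) → Fin (suc m)
  f i = lookup (x ∷ xs) (cast len′ i)

  pos-f : ∀ i → pos (f i) ≡ toℕ i
  pos-f i = trans (numbered-lookup (x ∷ xs) num (cast len′ i)) (toℕ-cast len′ i)

  f-inj : Injective _≡_ _≡_ f
  f-inj {i} {j} fi≡fj = toℕ-injective (begin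
    toℕ i     ≡⟨ pos-f i ⟨
    pos (f i) ≡⟨ cong pos fi≡fj ⟩
    pos (f j) ≡⟨ pos-f j ⟩
    toℕ j     ∎)

  f-separates : ∀ {i j} → i ≢ j → f i ≢ f j
  f-separates i≢j = i≢j ∘ f-inj

  step : ∀ (i : Fin m) → R (f (inject₁ i)) (f (suc i))
  step i = linked-lookup linked (cast len′ (inject₁ i)) (cast len′ (suc i)) (begin
    toℕ (cast len′ (suc i))          ≡⟨ toℕ-cast len′ (suc i) ⟩
    suc (toℕ i)                      ≡⟨ cong suc (toℕ-inject₁ i) ⟨
    suc (toℕ (inject₁ i))            ≡⟨ cong suc (toℕ-cast len′ (inject₁ i)) ⟨
    suc (toℕ (cast len′ (inject₁ i))) ∎)

  last-index : toℕ (cast len′ (fromℕ m)) ≡ length xs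
  last-index = begin
    toℕ (cast len′ (fromℕ m)) ≡⟨ toℕ-cast len′ (fromℕ m) ⟩
    toℕ (fromℕ m)             ≡⟨ toℕ-fromℕ m ⟩
    m                         ≡⟨ len ⟨
    length xs                 ∎

  closes : R (f (fromℕ m)) (f zero)
  closes = subst (λ z → R z x) (sym (lookup-last⁺ x xs (cast len′ (fromℕ m)) last-index)) closing

vertex : ∀ {n} → Kind n → Fin (n + (n + 1))
vertex {n} (orig i)  = i ↑ˡ (n + 1)
vertex {n} (prime i) = n ↑ʳ (i ↑ˡ 1)
vertex {n} apex      = n ↑ʳ (n ↑ʳ zero)

kind-vertex : ∀ {n} (x : Kind n) → kind (vertex x) ≡ x
kind-vertex {n} (orig i)  rewrite splitAt-↑ˡ n i (n + 1) = refl
kind-vertex {n} (prime i) rewrite splitAt-↑ʳ n (n + 1) (i ↑ˡ 1) | splitAt-↑ˡ n i 1 = refl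
kind-vertex {n} apex      rewrite splitAt-↑ʳ n (n + 1) (n ↑ʳ (zero {0})) | splitAt-↑ʳ n 1 (zero {0}) = refl

M-nonadjacent : ∀ G (x y : Kind (n G)) → ¬ MAdjK (Adj G) x y → ¬ Adj (M G) (vertex x) (vertex y)
M-nonadjacent G x y x≁y rewrite kind-vertex x | kind-vertex y = x≁y

Loopless : Graph → Set
Loopless G = ∀ i → ¬ Adj G i i

M-loopless : ∀ G → Loopless G → Loopless (M G)
M-loopless G loopless i with kind {n G} i
... | orig j  = loopless j
... | prime j = λ ()
... | apex    = λ ()

M^-loopless : ∀ G t → Loopless G → Loopless (M^ t G)
M^-loopless G zero    loopless = loopless
M^-loopless G (suc t) loopless = M-loopless (M^ t G) (M^-loopless G t loopless)

M^-nonempty : ∀ G t → n G ≥ 1 → n (M^ t G) ≥ 1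
M^-nonempty G zero    n≥1 = n≥1
M^-nonempty G (suc t) _   = ≤-trans (m≤n+m 1 k) (m≤n+m (k + 1) k)
  where k = n (M^ t G)

module ComplementM² {n₀ : ℕ} (A : Fin (suc n₀) → Fin (suc n₀) → Set) (loopless : ∀ i → ¬ A i i) where
  H : Graph
  H = mkGraph (suc n₀) A

  V : Set
  V = Fin (n (M (M H)))

  R : V → V → Set
  R p q = ¬ Adj (M (M H)) p q

  a b : Fin (suc n₀) → Fin (n (M H))
  a i = vertex {n H} (orig i)
  b i = vertex {n H} (prime i)

  c : Fin (n (M H))
  c = vertex {n H} apex

  O P : Fin (n (M H)) → V
  O x = vertex {n (M H)} (orig x)
  P x = vertex {n (M H)} (prime x)

  u : V
  u = vertex {n (M H)} apex

  a≁a : ∀ i → ¬ Adj (M H) (a i) (a i)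
  a≁a i = M-nonadjacent H (orig i) (orig i) (loopless i)

  b≁a : ∀ i → ¬ Adj (M H) (b i) (a i)
  b≁a i = M-nonadjacent H (prime i) (orig i) (loopless i)

  b≁b : ∀ i → ¬ Adj (M H) (b i) (b i)
  b≁b i = M-nonadjacent H (prime i) (prime i) λ ()

  c≁c : ¬ Adj (M H) c c
  c≁c = M-nonadjacent H apex apex λ ()

  R-OO : ∀ x y → ¬ Adj (M H) x y → R (O x) (O y)
  R-OO x y = M-nonadjacent (M H) (orig x) (orig y)

  R-OP : ∀ x y → ¬ Adj (M H) x y → R (O x) (P y)
  R-OP x y = M-nonadjacent (M H) (orig x) (prime y)

  R-PO : ∀ x y → ¬ Adj (M H) y x → R (P x) (O y)
  R-PO x y = M-nonadjacent (M H) (prime x) (orig y)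

  R-PP : ∀ x y → R (P x) (P y)
  R-PP x y = M-nonadjacent (M H) (prime x) (prime y) λ ()

  R-uO : ∀ x → R u (O x)
  R-uO x = M-nonadjacent (M H) apex (orig x) λ ()

  R-Ou : ∀ x → R (O x) u
  R-Ou x = M-nonadjacent (M H) (orig x) apex λ ()

  -- The index of each vertex on the cycle of the header.
  positionO positionP : Kind (n H) → ℕ
  positionO (orig zero)     = 1
  positionO (prime zero)    = 3
  positionO (orig (suc j))  = 7 + toℕ j * 4
  positionO (prime (suc j)) = 6 + toℕ j * 4
  positionO apex            = 6 + n₀ * 4
  positionP (orig zero)     = 2
  positionP (prime zero)    = 4
  positionP (orig (suc j))  = 8 + toℕ j * 4
  positionP (prime (suc j)) = 5 + toℕ j * 4
  positionP apex            = 5 + n₀ * 4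

  position : Kind (n (M H)) → ℕ
  position (orig x)  = positionO (kind x)
  position (prime x) = positionP (kind x)
  position apex      = 0

  pos : V → ℕ
  pos = position ∘ kind

  pos-vertex : ∀ X → pos (vertex X) ≡ position X
  pos-vertex X = cong position (kind-vertex X)

  pos-O : ∀ x → pos (O (vertex x)) ≡ positionO x
  pos-O x = trans (pos-vertex (orig (vertex x))) (cong positionO (kind-vertex x))

  pos-P : ∀ x → pos (P (vertex x)) ≡ positionP x
  pos-P x = trans (pos-vertex (prime (vertex x))) (cong positionP (kind-vertex x))

  blocks : List (Fin n₀) → List V
  blocks []       = P c ∷ O c ∷ []
  blocks (j ∷ js) = P (b (suc j)) ∷ O (b (suc j)) ∷ O (a (suc j)) ∷ P (a (suc j)) ∷ blocks js

  length-blocks : ∀ js → length (blocks js) ≡ length js * 4 + 2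
  length-blocks []       = refl
  length-blocks (j ∷ js) = cong (4 +_) (length-blocks js)

  last-blocks : ∀ x js → last⁺ x (blocks js) ≡ O c
  last-blocks x []       = refl
  last-blocks x (j ∷ js) = last-blocks (P (a (suc j))) js

  linked-blocks : ∀ x js → Linked R (P x ∷ blocks js)
  linked-blocks x []       = R-PP x c ∷ R-PO c c c≁c ∷ [-]
  linked-blocks x (j ∷ js) =
    R-PP x (b j′) ∷ R-PO (b j′) (b j′) (b≁b j′) ∷ R-OO (b j′) (a j′) (b≁a j′) ∷ R-OP (a j′) (a j′) (a≁a j′) ∷
    linked-blocks (a j′) js
    where j′ = suc j

  numbered-blocks : ∀ {s} js → s + length js ≡ n₀ → Numbered toℕ s js → Numbered pos (5 + s * 4) (blocks js)
  numbered-blocks {s} [] s+0≡n₀ _ =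
    trans (pos-P apex) (cong (λ k → 5 + k * 4) n₀≡s) , trans (pos-O apex) (cong (λ k → 6 + k * 4) n₀≡s) , tt
    where
    n₀≡s : n₀ ≡ s
    n₀≡s = trans (sym s+0≡n₀) (+-identityʳ s)
  numbered-blocks (j ∷ js) len (refl , num) =
    pos-P (prime (suc j)) , pos-O (prime (suc j)) , pos-O (orig (suc j)) , pos-P (orig (suc j)) ,
    numbered-blocks js (trans (sym (+-suc (toℕ j) (length js))) len) num

  cycle : List V
  cycle = O (a zero) ∷ P (a zero) ∷ O (b zero) ∷ P (b zero) ∷ blocks (allFin n₀)

  length-cycle : length cycle ≡ n₀ + (suc n₀ + 1) + (suc (n₀ + (suc n₀ + 1)) + 1)
  length-cycle = begin
    4 + length (blocks (allFin n₀))      ≡⟨ cong (4 +_) (length-blocks (allFin n₀)) ⟩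
    4 + (length (allFin n₀) * 4 + 2)     ≡⟨ cong (λ k → 4 + (k * 4 + 2)) (length-tabulate {n = n₀} id) ⟩
    4 + (n₀ * 4 + 2)                     ≡⟨ vertex-count n₀ ⟩
    n₀ + (suc n₀ + 1) + (suc (n₀ + (suc n₀ + 1)) + 1) ∎
    where
    open ≡-Reasoning
    vertex-count : ∀ k → 4 + (k * 4 + 2) ≡ k + (suc k + 1) + (suc (k + (suc k + 1)) + 1)
    vertex-count = solve-∀

  hamiltonian : IsHamiltonian (complement (M (M H)))
  hamiltonian = linked⇒hamCycle (subst (_≥ 2) length-cycle (s≤s (s≤s z≤n))) length-cycle numbered linked closing
    where
    numbered : Numbered pos 0 (u ∷ cycle)
    numbered =
      pos-vertex apex , pos-O (orig zero) , pos-P (orig zero) , pos-O (prime zero) , pos-P (prime zero) ,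
      numbered-blocks (allFin n₀) (length-tabulate {n = n₀} id) (numbered-tabulate id λ _ → refl)

    linked : Linked R (u ∷ cycle)
    linked =
      R-uO (a zero) ∷ R-OP (a zero) (a zero) (a≁a zero) ∷ R-PO (a zero) (b zero) (b≁a zero) ∷
      R-OP (b zero) (b zero) (b≁b zero) ∷ linked-blocks (b zero) (allFin n₀)

    closing : R (last⁺ u cycle) u
    closing = subst (λ z → R z u) (sym (last-blocks (P (b zero)) (allFin n₀))) (R-Ou c)

complement-M²-hamiltonian : ∀ H → n H ≥ 1 → Loopless H → IsHamiltonian (complement (M (M H)))
complement-M²-hamiltonian (mkGraph (suc n₀) A) _ loopless = ComplementM².hamiltonian A loopless

corollary4p2 : (G : Graph) → IsSimple G → n G ≥ 1 → (t : ℕ) → t ≥ 2 →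
    IsHamiltonian (complement (M^ t G))
corollary4p2 G (_ , loopless) n≥1 (suc (suc t)) _ =
  complement-M²-hamiltonian (M^ t G) (M^-nonempty G t n≥1) (M^-loopless G t loopless)
corollary4p2 G _ _ (suc zero) (s≤s ())
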